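{- Let $X$ be a nonempty set, let $\mathcal{F}$ be a family of subsets of $X$ which is closed under intersections and contains $X$, and let $L$ be a complete lattice. Then $$\mathcal{N}(L,\mathcal{F})=\bigcup_{L_0\in\mathcal{S}(L,\mathcal{F})}H_{(L,L_0,\mathcal{F})}.$$
   Context: For a complete lattice $K$ and $\mu:X\to K$ (a $K$-fuzzy set), $\mu_p=\{x\in X\mid\mu(x)\geq p\}$ for $p\in K$, $\mu_K=\{\mu_p\mid p\in K\}$, and $K^{\mu}=\{p\in K\mid p=\bigwedge B\text{ for some }B\subseteq\mu(X)\}$ (infima in $K$; $\bigwedge\emptyset$ is the top of $K$). For a sub-poset $P$ of $L$, $\iota_{(P,L)}$ is the inclusion map, and "$P$ can be embedded into $L$ by $\iota_{(P,L)}$-embedding" means: for every $S\subseteq P$ the infimum of $S$ in $P$ exists and equals its infimum in $L$, and the top of $P$ is $1_L$. Define $\mathcal{N}(L,\mathcal{F})=\{f\mid f:X\to L,\ f_L=\mathcal{F}\}$; $\mathcal{S}(L,\mathcal{F})=\{P\subseteq L\mid P \text{ can be embedded into } L \text{ by } \iota_{(P,L)}\text{ -embedding and } (P,\leq)\cong(\mathcal{F},\supseteq)\}$; for $L_0\subseteq L$, $H_{(L,L_0,\mathcal{F})}=\{\mu\mid \mu:X\to L,\ L^{\mu}=L_0,\ \mu_L=\mathcal{F}\}$. -}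

module Defs where

open import Level using (Level; _⊔_) renaming (suc to lsuc; zero to 0ℓ)
open import Data.Product using (Σ; ∃; ∃-syntax; _×_; _,_)
open import Data.Unit using (⊤)
open import Relation.Binary.PropositionalEquality using (_≡_)
open import Relation.Binary.Structures using (IsPartialOrder)

Subset : Set → Set₁
Subset X = X → Set

_≐_ : ∀ {a b} {X : Set} → (X → Set a) → (X → Set b) → Set (a ⊔ b)
A ≐ B = (∀ x → A x → B x) × (∀ x → B x → A x)

_⊆_ : ∀ {a b} {X : Set} → (X → Set a) → (X → Set b) → Set (a ⊔ b)
A ⊆ B = ∀ x → A x → B x

Family : Set → Set₂
Family X = Subset X → Set₁

_∈ᶠ_ : ∀ {a} {X : Set} → (X → Set a) → Family X → Set (lsuc 0ℓ ⊔ a)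
A ∈ᶠ 𝓕 = ∃[ B ] (𝓕 B × A ≐ B)

_≐ᶠ_ : {X : Set} → Family X → Family X → Set₁
𝓐 ≐ᶠ 𝓑 = (∀ A → 𝓐 A → A ∈ᶠ 𝓑) × (∀ B → 𝓑 B → B ∈ᶠ 𝓐)

⋂ᶠ : {X : Set} → Family X → X → Set₁
⋂ᶠ 𝓖 x = ∀ A → 𝓖 A → A x

ClosedUnderIntersections : {X : Set} → Family X → Set₂
ClosedUnderIntersections 𝓕 =
  ∀ (𝓖 : Family _) → (∀ A → 𝓖 A → A ∈ᶠ 𝓕) → ⋂ᶠ 𝓖 ∈ᶠ 𝓕

ContainsWhole : {X : Set} → Family X → Set₁
ContainsWhole 𝓕 = (λ _ → ⊤) ∈ᶠ 𝓕

record CompleteLattice : Set₁ where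
  field
    Carrier        : Set
    _≤_            : Carrier → Carrier → Set
    isPartialOrder : IsPartialOrder _≡_ _≤_
    ⋀              : Subset Carrier → Carrier
    ⋀-lower        : ∀ S p → S p → ⋀ S ≤ p
    ⋀-greatest     : ∀ S q → (∀ p → S p → q ≤ p) → q ≤ ⋀ S
    ⋁              : Subset Carrier → Carrier
    ⋁-upper        : ∀ S p → S p → p ≤ ⋁ S
    ⋁-least        : ∀ S q → (∀ p → S p → p ≤ q) → ⋁ S ≤ q

  ⊤L : Carrier
  ⊤L = ⋀ (λ _ → Data.Empty.⊥)
    where import Data.Empty

module _ (L : CompleteLattice) where
  open CompleteLattice L

  IsTop : Carrier → Set
  IsTop t = ∀ p → p ≤ t

  cut : {X : Set} → (X → Carrier) → Carrier → Subset X
  cut μ p x = p ≤ μ x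

  cuts : {X : Set} → (X → Carrier) → Family X
  cuts μ A = ∃[ p ] (A ≐ cut μ p) × Lift⊤
    where Lift⊤ = Level.Lift (lsuc 0ℓ) ⊤

  Lμ : {X : Set} → (X → Carrier) → Carrier → Set₁
  Lμ {X} μ p = ∃[ B ] ((∀ q → B q → ∃[ x ] μ x ≡ q) × p ≡ ⋀ B)

  IsInfIn : Subset Carrier → Subset Carrier → Carrier → Set
  IsInfIn P S m = P m × (∀ p → S p → m ≤ p)
                      × (∀ q → P q → (∀ p → S p → q ≤ p) → q ≤ m)

  ιEmbedding : Subset Carrier → Set₁
  ιEmbedding P =
    (∀ (S : Subset Carrier) → S ⊆ P → ∃[ m ] (IsInfIn P S m × m ≡ ⋀ S))
    × ∃[ t ] (P t × (∀ q → P q → q ≤ t) × t ≡ ⊤L)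

  OrderIso : {X : Set} → Subset Carrier → Family X → Set₁
  OrderIso {X} P 𝓕 =
    Σ ((p : Carrier) → P p → Subset X) λ φ →
        (∀ p (pp : P p) → φ p pp ∈ᶠ 𝓕)
      × (∀ p (pp : P p) q (qp : P q) → (p ≤ q → φ q qp ⊆ φ p pp)
                                      × (φ q qp ⊆ φ p pp → p ≤ q))
      × (∀ B → 𝓕 B → ∃[ p ] ∃[ pp ] (φ p pp ≐ B))

  𝓝 : {X : Set} → Family X → (X → Carrier) → Set₁
  𝓝 𝓕 f = cuts f ≐ᶠ 𝓕

  𝓢 : {X : Set} → Family X → Subset Carrier → Set₁
  𝓢 𝓕 P = ιEmbedding P × OrderIso P 𝓕

  H : {X : Set} → Subset Carrier → Family X → (X → Carrier) → Set₁
  H L₀ 𝓕 μ = (∀ p → (Lμ μ p → L₀ p) × (L₀ p → Lμ μ p)) × (cuts μ ≐ᶠ 𝓕)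

-- The fuzzy set f itself is the witness: take L₀ = L^f, which is the set of
-- fixed points of the closure operator p ↦ ⋀ { f x | p ≤ f x } on L.  Fixed
-- points of a closure operator are closed under all meets in L, so L^f is
-- ι-embedded; the cut map p ↦ f_p is an order anti-isomorphism from L^f onto
-- f_L, because every cut f_p equals the cut at the closure of p.  When
-- f_L = 𝓕 this exhibits L^f ∈ 𝓢(L,𝓕) and f ∈ H(L,L^f,𝓕); the converse is
-- part of the definition of H.
module Submission where

open import Defs
open import Data.Product using (∃-syntax; _×_; _,_; proj₂)
open import Data.Unit using (tt)
open import Function.Bundles using (_⇔_; mk⇔)
open import Level using (lift)
open import Relation.Binary.PropositionalEquality using (_≡_; refl; sym; subst)
open import Relation.Binary.Structures using (IsPartialOrder)

module _ {X : Set} where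

  ≐-refl : ∀ {a} {A : X → Set a} → A ≐ A
  ≐-refl = (λ _ h → h) , (λ _ h → h)

  ≐-sym : ∀ {a b} {A : X → Set a} {B : X → Set b} → A ≐ B → B ≐ A
  ≐-sym (A⊆B , B⊆A) = B⊆A , A⊆B

  ≐-trans : ∀ {a b c} {A : X → Set a} {B : X → Set b} {C : X → Set c} →
            A ≐ B → B ≐ C → A ≐ C
  ≐-trans (A⊆B , B⊆A) (B⊆C , C⊆B) =
    (λ x h → B⊆C x (A⊆B x h)) , (λ x h → B⊆A x (C⊆B x h))

  ∈ᶠ-≐ᶠ : ∀ {a} {A : X → Set a} {𝓐 𝓑 : Family X} → A ∈ᶠ 𝓐 → 𝓐 ≐ᶠ 𝓑 → A ∈ᶠ 𝓑
  ∈ᶠ-≐ᶠ (B , 𝓐B , A≐B) (𝓐⊆𝓑 , _) =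
    let C , 𝓑C , B≐C = 𝓐⊆𝓑 B 𝓐B in C , 𝓑C , ≐-trans A≐B B≐C

module _ (L : CompleteLattice) where
  open CompleteLattice L
  open IsPartialOrder isPartialOrder using (antisym; reflexive) renaming (trans to ≤-trans)

  OrderIso-≐ᶠ : ∀ {X} {P : Subset Carrier} {𝓐 𝓑 : Family X} →
                OrderIso L P 𝓐 → 𝓐 ≐ᶠ 𝓑 → OrderIso L P 𝓑
  OrderIso-≐ᶠ (φ , φ∈𝓐 , φ-order , φ-onto) 𝓐≐𝓑 =
      φ
    , (λ p pp → ∈ᶠ-≐ᶠ (φ∈𝓐 p pp) 𝓐≐𝓑)
    , φ-order
    , λ B 𝓑B →
        let C , 𝓐C , B≐C = proj₂ 𝓐≐𝓑 B 𝓑B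
            p , pp , φp≐C = φ-onto C 𝓐C
        in p , pp , ≐-trans φp≐C (≐-sym B≐C)

  module _ {X : Set} (f : X → Carrier) where

    ValuesAbove : Carrier → Subset Carrier
    ValuesAbove p q = ∃[ x ] (f x ≡ q × p ≤ q)

    closure : Carrier → Carrier
    closure p = ⋀ (ValuesAbove p)

    Closed : Subset Carrier
    Closed p = p ≡ closure p

    closure-extensive : ∀ p → p ≤ closure p
    closure-extensive p = ⋀-greatest _ p (λ { _ (_ , _ , p≤q) → p≤q })

    closure-monotone : ∀ {p q} → p ≤ q → closure p ≤ closure q
    closure-monotone p≤q = ⋀-greatest _ _
      (λ { r (x , fx≡r , q≤r) → ⋀-lower _ r (x , fx≡r , ≤-trans p≤q q≤r) })

    closure-least : ∀ {p} x → p ≤ f x → closure p ≤ f x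
    closure-least x p≤fx = ⋀-lower _ (f x) (x , refl , p≤fx)

    Closed-⋀ : ∀ S → S ⊆ Closed → Closed (⋀ S)
    Closed-⋀ S S⊆Closed = antisym (closure-extensive (⋀ S))
      (⋀-greatest S _ (λ s Ss →
        ≤-trans (closure-monotone (⋀-lower S s Ss)) (reflexive (sym (S⊆Closed s Ss)))))

    value-Closed : ∀ x → Closed (f x)
    value-Closed x = antisym (closure-extensive (f x)) (closure-least x (reflexive refl))

    Lμ⇒Closed : ∀ {p} → Lμ L f p → Closed p
    Lμ⇒Closed (B , B⊆image , refl) =
      Closed-⋀ B (λ { q Bq → let x , fx≡q = B⊆image q Bq in subst Closed fx≡q (value-Closed x) })

    closure-Lμ : ∀ p → Lμ L f (closure p)
    closure-Lμ p = ValuesAbove p , (λ { _ (x , fx≡q , _) → x , fx≡q }) , refl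

    Closed⇒Lμ : ∀ {p} → Closed p → Lμ L f p
    Closed⇒Lμ {p} p≡closure = subst (Lμ L f) (sym p≡closure) (closure-Lμ p)

    closure-Closed : ∀ p → Closed (closure p)
    closure-Closed p = Lμ⇒Closed (closure-Lμ p)

    Closed-ιEmbedding : ιEmbedding L Closed
    Closed-ιEmbedding =
        (λ S S⊆Closed → ⋀ S , (Closed-⋀ S S⊆Closed , ⋀-lower S , (λ q _ → ⋀-greatest S q)) , refl)
      , ⊤L , Closed-⋀ _ (λ _ ()) , (λ q _ → ⋀-greatest _ q (λ _ ())) , refl

    cut-closure : ∀ p → cut L f (closure p) ≐ cut L f p
    cut-closure p = (λ _ → ≤-trans (closure-extensive p)) , closure-least

    cut-⊆⇒≤-closure : ∀ {p q} → cut L f q ⊆ cut L f p → p ≤ closure q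
    cut-⊆⇒≤-closure cutq⊆cutp = ⋀-greatest _ _ (λ { _ (x , refl , q≤fx) → cutq⊆cutp x q≤fx })

    Closed-OrderIso-cuts : OrderIso L Closed (cuts L f)
    Closed-OrderIso-cuts =
        (λ p _ → cut L f p)
      , (λ p _ → cut L f p , (p , ≐-refl , lift tt) , ≐-refl)
      , (λ p _ q q-closed →
            (λ p≤q _ q≤fx → ≤-trans p≤q q≤fx)
          , (λ cutq⊆cutp → subst (p ≤_) (sym q-closed) (cut-⊆⇒≤-closure cutq⊆cutp)))
      , λ { B (p , B≐cutp , _) →
              closure p , closure-Closed p , ≐-trans (cut-closure p) (≐-sym B≐cutp) }

lemma6 : (X : Set) → X → (𝓕 : Family X) → ClosedUnderIntersections 𝓕 → ContainsWhole 𝓕 →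
    (L : CompleteLattice) → (f : X → CompleteLattice.Carrier L) →
      𝓝 L 𝓕 f ⇔ (∃[ L₀ ] (𝓢 L 𝓕 L₀ × H L L₀ 𝓕 f))
lemma6 X _ 𝓕 _ _ L f = mk⇔
  (λ f∈𝓝 → Closed L f
         , (Closed-ιEmbedding L f , OrderIso-≐ᶠ L (Closed-OrderIso-cuts L f) f∈𝓝)
         , (λ _ → Lμ⇒Closed L f , Closed⇒Lμ L f)
         , f∈𝓝)
  (λ { (_ , _ , _ , f∈𝓝) → f∈𝓝 })
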